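{- Let $L,R$ be nonempty subsets of a group $G$ such that $\mathcal{W}(L)$ and $\mathcal{W}(R)$ are subgroups of $G$. In $2\mathrm{S}(G;L,R)$, a vertex $g$ is weakly connected to a vertex $h$ if and only if $g$ is strongly connected to $h$; hence the weakly connected components of $2\mathrm{S}(G;L,R)$ are identical to its strongly connected components.
   Context: For a group $G$ and nonempty subsets $L,R\subseteq G$, the two-sided group digraph $2\mathrm{S}(G;L,R)$ has vertex set $G$ and a directed arc $(g,h)$ if and only if $h=l^{ -1}gr$ for some $l\in L$, $r\in R$. Vertex $g$ is weakly connected to $h$ if there is a sequence $g=g_0,\dots,g_k=h$ such that for each $i$ either $(g_{i-1},g_i)$ or $(g_i,g_{i-1})$ is an arc; $g$ is strongly connected to $h$ if there are directed paths from $g$ to $h$ and from $h$ to $g$. $\mathcal{W}(S)$ is the set of all elements $s_1\cdots s_n$ with $n\ge1$ and all $s_i\in S$. -}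

module Defs where

open import Level using (Level; _⊔_)
open import Algebra.Bundles using (Group)
open import Data.List.NonEmpty using (List⁺; foldr₁; toList)
open import Data.List.Relation.Unary.All using (All)
open import Data.Product using (Σ; ∃; _×_)
open import Data.Sum using (_⊎_)
open import Relation.Unary using (Pred)

module TwoSided {c ℓ : Level} (G : Group c ℓ) where
  open Group G

  𝒲 : {p : Level} → Pred Carrier p → Pred Carrier (c ⊔ ℓ ⊔ p)
  𝒲 S x = Σ (List⁺ Carrier) (λ ws → All S (toList ws) × foldr₁ _∙_ ws ≈ x)

  record IsSubgroup {p : Level} (H : Pred Carrier p) : Set (c ⊔ p) where
    field
      ε∈   : H ε
      ∙∈   : ∀ {x y} → H x → H y → H (x ∙ y)
      ⁻¹∈  : ∀ {x} → H x → H (x ⁻¹)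

  Nonempty : {p : Level} → Pred Carrier p → Set (c ⊔ p)
  Nonempty S = ∃ λ x → S x

  module Digraph {p q : Level} (L : Pred Carrier p) (R : Pred Carrier q) where
    Arc : Carrier → Carrier → Set (c ⊔ ℓ ⊔ p ⊔ q)
    Arc g h = Σ Carrier λ l → Σ Carrier λ r → L l × R r × (h ≈ (l ⁻¹ ∙ g) ∙ r)

    data Path : Carrier → Carrier → Set (c ⊔ ℓ ⊔ p ⊔ q) where
      here  : ∀ {g h} → g ≈ h → Path g h
      there : ∀ {g k h} → Arc g k → Path k h → Path g h

    data UPath : Carrier → Carrier → Set (c ⊔ ℓ ⊔ p ⊔ q) where
      here  : ∀ {g h} → g ≈ h → UPath g h
      there : ∀ {g k h} → (Arc g k ⊎ Arc k g) → UPath k h → UPath g h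

    WeaklyConnected : Carrier → Carrier → Set (c ⊔ ℓ ⊔ p ⊔ q)
    WeaklyConnected = UPath

    StronglyConnected : Carrier → Carrier → Set (c ⊔ ℓ ⊔ p ⊔ q)
    StronglyConnected g h = Path g h × Path h g

module Submission where

-- Write x ↦ a⁻¹ x b for the two-sided action of a pair (a, b).  A directed
-- walk of length n from x is obtained by acting with (l₁ ⋯ lₙ, r₁ ⋯ rₙ) for
-- lᵢ ∈ L, rᵢ ∈ R; so x reaches a⁻¹ x b whenever a and b are products of the
-- SAME number of elements of L and R respectively.  Since acting with
-- (l⁻¹, r⁻¹) undoes the arc g ↦ l⁻¹ g r, every arc can be reversed by a
-- directed walk as soon as l⁻¹ and r⁻¹ are products of equally many letters.
-- The subgroup hypotheses give words for l⁻¹ and r⁻¹ of some lengths n and m,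
-- and also words for ε of lengths n + 1 and m + 1 (namely l · l⁻¹, r · r⁻¹);
-- padding with m copies resp. n copies of these equalises the two lengths.
-- Once arcs are reversible, directed reachability is symmetric, hence equals
-- weak connectivity.

open import Defs
open import Level using (Level; _⊔_)
open import Algebra.Bundles using (Group)
open import Relation.Unary using (Pred)
open import Function.Bundles using (_⇔_; mk⇔)
open import Data.Nat using (ℕ; zero; suc; _+_; _*_)
open import Data.Nat.Tactic.RingSolver using (solve-∀)
open import Data.List using ([]; _∷_; length)
open import Data.List.NonEmpty using (_∷_; foldr₁)
open import Data.List.Relation.Unary.All using (All; []; _∷_)
open import Data.Product using (∃; _×_; _,_)
open import Data.Sum using (inj₁; inj₂)
open import Relation.Binary.PropositionalEquality as ≡ using (_≡_)
import Algebra.Properties.Group as GroupProperties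
import Relation.Binary.Reasoning.Setoid as SetoidReasoning

module Words {c ℓ : Level} (G : Group c ℓ) where
  open Group G
  open TwoSided G

  data Word {s : Level} (S : Pred Carrier s) : ℕ → Carrier → Set (c ⊔ ℓ ⊔ s) where
    nil  : ∀ {x} → x ≈ ε → Word S 0 x
    cons : ∀ {n x y a} → S y → Word S n a → x ≈ y ∙ a → Word S (suc n) x

  module _ {s : Level} {S : Pred Carrier s} where

    word-resp : ∀ {n x y} → Word S n x → x ≈ y → Word S n y
    word-resp (nil x≈ε)      x≈y = nil (trans (sym x≈y) x≈ε)
    word-resp (cons sy w x≈) x≈y = cons sy w (trans (sym x≈y) x≈)

    word-∙ : ∀ {n m a b} → Word S n a → Word S m b → Word S (n + m) (a ∙ b)
    word-∙ {b = b} (nil a≈ε) v = word-resp v (sym (trans (∙-congʳ a≈ε) (identityˡ b)))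
    word-∙ {b = b} (cons {y = y} {a = a} sy w x≈) v =
      cons sy (word-∙ w v) (trans (∙-congʳ x≈) (assoc y a b))

    fromLetters : ∀ x xs → All S (x ∷ xs) → Word S (suc (length xs)) (foldr₁ _∙_ (x ∷ xs))
    fromLetters x []       (sx ∷ []) = cons sx (nil refl) (sym (identityʳ x))
    fromLetters x (y ∷ xs) (sx ∷ ss) = cons sx (fromLetters y xs ss) refl

    from𝒲 : ∀ {x} → 𝒲 S x → ∃ λ n → Word S n x
    from𝒲 ((y ∷ ys) , ss , y⋯≈x) = suc (length ys) , word-resp (fromLetters y ys ss) y⋯≈x

    unitWord : ∀ {n y} → S y → Word S n (y ⁻¹) → Word S (suc n) ε
    unitWord sy w = cons sy w (sym (inverseʳ _))

    unitPower : ∀ {n} → Word S n ε → ∀ k → Word S (k * n) ε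
    unitPower u zero    = nil refl
    unitPower u (suc k) = word-resp (word-∙ u (unitPower u k)) (identityˡ ε)

    pad : ∀ {n m x} → Word S n x → Word S m ε → ∀ k → Word S (n + k * m) x
    pad w u k = word-resp (word-∙ w (unitPower u k)) (identityʳ _)

module Action {c ℓ : Level} (G : Group c ℓ) where
  open Group G
  open GroupProperties G
  open SetoidReasoning setoid

  act : Carrier → Carrier → Carrier → Carrier
  act a b x = (a ⁻¹ ∙ x) ∙ b

  act-cong : ∀ {a b x y} → x ≈ y → act a b x ≈ act a b y
  act-cong x≈y = ∙-congʳ (∙-congˡ x≈y)

  act-ε : ∀ x → act ε ε x ≈ x
  act-ε x = begin
    (ε ⁻¹ ∙ x) ∙ ε ≈⟨ identityʳ _ ⟩
    ε ⁻¹ ∙ x       ≈⟨ ∙-congʳ ε⁻¹≈ε ⟩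
    ε ∙ x          ≈⟨ identityˡ x ⟩
    x              ∎

  act-∙ : ∀ l a r b x → act (l ∙ a) (r ∙ b) x ≈ act a b (act l r x)
  act-∙ l a r b x = begin
    ((l ∙ a) ⁻¹ ∙ x) ∙ (r ∙ b)       ≈⟨ ∙-congʳ (∙-congʳ (⁻¹-anti-homo-∙ l a)) ⟩
    ((a ⁻¹ ∙ l ⁻¹) ∙ x) ∙ (r ∙ b)    ≈⟨ sym (assoc _ r b) ⟩
    (((a ⁻¹ ∙ l ⁻¹) ∙ x) ∙ r) ∙ b    ≈⟨ ∙-congʳ (∙-congʳ (assoc (a ⁻¹) (l ⁻¹) x)) ⟩
    ((a ⁻¹ ∙ (l ⁻¹ ∙ x)) ∙ r) ∙ b    ≈⟨ ∙-congʳ (assoc (a ⁻¹) _ r) ⟩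
    (a ⁻¹ ∙ ((l ⁻¹ ∙ x) ∙ r)) ∙ b    ∎

  act-undo : ∀ l r x → act (l ⁻¹) (r ⁻¹) (act l r x) ≈ x
  act-undo l r x = begin
    act (l ⁻¹) (r ⁻¹) (act l r x) ≈⟨ sym (act-∙ l (l ⁻¹) r (r ⁻¹) x) ⟩
    act (l ∙ l ⁻¹) (r ∙ r ⁻¹) x   ≈⟨ ∙-cong (∙-congʳ (⁻¹-cong (inverseʳ l))) (inverseʳ r) ⟩
    act ε ε x                      ≈⟨ act-ε x ⟩
    x                              ∎

module Walks {c ℓ p q : Level} (G : Group c ℓ)
    (L : Pred (Group.Carrier G) p) (R : Pred (Group.Carrier G) q) where
  open Group G
  open TwoSided G
  open Digraph L R
  open Words G
  open Action G

  path-resp : ∀ {g h h′} → Path g h → h ≈ h′ → Path g h′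
  path-resp (here g≈h)   h≈h′ = here (trans g≈h h≈h′)
  path-resp (there a ps) h≈h′ = there a (path-resp ps h≈h′)

  arc-respˡ : ∀ {g g′ k} → g′ ≈ g → Arc g k → Arc g′ k
  arc-respˡ g′≈g (l , r , ll , rr , k≈) = l , r , ll , rr , trans k≈ (act-cong (sym g′≈g))

  path-trans : ∀ {g k h} → Path g k → Path k h → Path g h
  path-trans (here g≈k)   (here k≈h)    = here (trans g≈k k≈h)
  path-trans (here g≈k)   (there a ps)  = there (arc-respˡ g≈k a) ps
  path-trans (there a ps) qs            = there a (path-trans ps qs)

  walk : ∀ {n a b} → Word L n a → Word R n b → ∀ x → Path x (act a b x)
  walk (nil a≈ε) (nil b≈ε) x =
    here (sym (trans (∙-cong (∙-congʳ (⁻¹-cong a≈ε)) b≈ε) (act-ε x)))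
  walk (cons {y = l} {a = a} ll wl a≈) (cons {y = r} {a = b} rr wr b≈) x =
    there (l , r , ll , rr , refl)
      (path-resp (walk wl wr (act l r x))
        (sym (trans (∙-cong (∙-congʳ (⁻¹-cong a≈)) b≈) (act-∙ l a r b x))))

  module _ (reverseArc : ∀ {g k} → Arc g k → Path k g) where

    path-sym : ∀ {g h} → Path g h → Path h g
    path-sym (here g≈h)   = here (sym g≈h)
    path-sym (there a ps) = path-trans (path-sym ps) (reverseArc a)

    undirected⇒path : ∀ {g h} → UPath g h → Path g h
    undirected⇒path (here g≈h)          = here g≈h
    undirected⇒path (there (inj₁ a) us) = there a (undirected⇒path us)
    undirected⇒path (there (inj₂ a) us) = path-trans (reverseArc a) (undirected⇒path us)

  path⇒undirected : ∀ {g h} → Path g h → UPath g h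
  path⇒undirected (here g≈h)   = here g≈h
  path⇒undirected (there a ps) = there (inj₁ a) (path⇒undirected ps)

module Reversal {c ℓ p q : Level} (G : Group c ℓ)
    (L : Pred (Group.Carrier G) p) (R : Pred (Group.Carrier G) q)
    (𝒲L : TwoSided.IsSubgroup G (TwoSided.𝒲 G L))
    (𝒲R : TwoSided.IsSubgroup G (TwoSided.𝒲 G R)) where
  open Group G
  open TwoSided G
  open IsSubgroup
  open Digraph L R
  open Words G
  open Action G
  open Walks G L R

  letter : ∀ {s} {S : Pred Carrier s} {y} → S y → 𝒲 S y
  letter {y = y} sy = (y ∷ []) , (sy ∷ []) , refl

  -- Padding l⁻¹ (length n) by m units and r⁻¹ (length m) by n units.
  lengths-agree : ∀ n m → n + m * suc n ≡ m + n * suc m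
  lengths-agree = solve-∀

  balancedInverses : ∀ {l r} → L l → R r → ∃ λ k → Word L k (l ⁻¹) × Word R k (r ⁻¹)
  balancedInverses {l} ll rr with from𝒲 (⁻¹∈ 𝒲L (letter ll)) | from𝒲 (⁻¹∈ 𝒲R (letter rr))
  ... | n , wl | m , wr =
    m + n * suc m ,
    ≡.subst (λ k → Word L k (l ⁻¹)) (lengths-agree n m) (pad wl (unitWord ll wl) m) ,
    pad wr (unitWord rr wr) n

  reverseArc : ∀ {g k} → Arc g k → Path k g
  reverseArc {g} {k} (l , r , ll , rr , k≈) with balancedInverses ll rr
  ... | _ , wl , wr = path-resp (walk wl wr k) (trans (act-cong k≈) (act-undo l r g))

corollary3p8 : {c ℓ p q : Level} (G : Group c ℓ) (L : Pred (Group.Carrier G) p) (R : Pred (Group.Carrier G) q)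
    → TwoSided.Nonempty G L → TwoSided.Nonempty G R
    → TwoSided.IsSubgroup G (TwoSided.𝒲 G L) → TwoSided.IsSubgroup G (TwoSided.𝒲 G R)
    → (g h : Group.Carrier G)
    → TwoSided.Digraph.WeaklyConnected G L R g h ⇔ TwoSided.Digraph.StronglyConnected G L R g h
corollary3p8 G L R _ _ 𝒲L 𝒲R g h = mk⇔ weak⇒strong (λ (g⇝h , _) → path⇒undirected g⇝h)
  where
  open Walks G L R
  open Reversal G L R 𝒲L 𝒲R using (reverseArc)
  weak⇒strong : TwoSided.Digraph.UPath G L R g h → TwoSided.Digraph.StronglyConnected G L R g h
  weak⇒strong u = let g⇝h = undirected⇒path reverseArc u in g⇝h , path-sym reverseArc g⇝h
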